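{- Let $\mathbf{d}=(d_1,\ldots,d_n)$ be a graphic sequence and let $\delta\le n$ be a positive even integer. Then the sequence $\mathbf{d}\circ\delta=(d_1,\ldots,d_n,\delta)$ is graphic if and only if $\mathbf{d}$ has a realization containing a matching of size $\delta/2$.
   Context: A finite sequence of nonnegative integers is graphic if there is a simple graph with a vertex labelling whose degree sequence is that sequence; such a graph is a realization of the sequence. $\mathbf{d}\circ\delta$ denotes the sequence $\mathbf{d}$ with $\delta$ appended at the end. A matching is a set of pairwise disjoint edges. -}

module Defs where

open import Data.Nat using (ℕ; zero; suc; _+_; _*_; _≤_)
open import Data.Bool using (Bool; true; false; T)
open import Data.Fin using (Fin)
open import Data.Vec using (Vec; lookup; _∷ʳ_)
open import Data.List using (List; length; filter; allFin)
open import Data.Product using (Σ; _×_; _,_; proj₁; proj₂)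
open import Relation.Binary.PropositionalEquality using (_≡_; _≢_)
open import Relation.Nullary using (¬_)
open import Relation.Nullary.Decidable using (does)
open import Data.Bool.Properties using (T?)

record SimpleGraph (n : ℕ) : Set where
  field
    adj   : Fin n → Fin n → Bool
    sym   : ∀ i j → adj i j ≡ adj j i
    irrefl : ∀ i → adj i i ≡ false
open SimpleGraph public

degree : ∀ {n} → SimpleGraph n → Fin n → ℕ
degree G v = length (filter (λ w → T? (adj G v w)) (allFin _))

Realizes : ∀ {n} → SimpleGraph n → Vec ℕ n → Set
Realizes {n} G d = ∀ (i : Fin n) → degree G i ≡ lookup d i

Graphic : ∀ {n} → Vec ℕ n → Set
Graphic {n} d = Σ (SimpleGraph n) λ G → Realizes G d

record Matching {n : ℕ} (G : SimpleGraph n) (k : ℕ) : Set where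
  field
    edge     : Fin k → Fin n × Fin n
    isEdge   : ∀ a → T (adj G (proj₁ (edge a)) (proj₂ (edge a)))
    disjoint : ∀ a b → a ≢ b →
      (proj₁ (edge a) ≢ proj₁ (edge b)) × (proj₁ (edge a) ≢ proj₂ (edge b)) ×
      (proj₂ (edge a) ≢ proj₁ (edge b)) × (proj₂ (edge a) ≢ proj₂ (edge b))

-- Put the new vertex v last, let G be a realization of d extended by v as an isolated vertex, and H
-- a realization of d ∘ 2k; call the edges of G ∖ H red and those of H ∖ G blue. Away from v every
-- vertex has as many red as blue edges. While some blue edge xy avoids v, following blue edges to
-- vertices of ever larger red degree produces red edges xz, yw with zw not red, and a 2-switch of G
-- or of H along the 4-cycle x y w z shrinks the symmetric difference G ⊕ H without changing any
-- degree. Once every blue edge meets v, a blue edge vs is followed by a red edge st whose other end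
-- is again a blue neighbour of v; splitting off vs, vt (replacing them by st in H) and repeating
-- gives k disjoint red edges, a matching of G. Conversely, replacing each edge st of a matching by
-- vs and vt realizes d ∘ 2k.
module Submission where

open import Defs hiding (sym)
open import Data.Bool using (Bool; true; false; not; _∧_; _∨_; _xor_; T)
open import Data.Bool.Properties using () renaming (_≟_ to _≟ᵇ_)
open import Data.Bool.Properties
  using ( T?; T-≡; ¬-not; ∨-identityʳ; ∨-comm; ∧-comm; ∧-identityʳ; ∧-zeroʳ
        ; not-involutive; xor-identityʳ; xor-comm; xor-assoc)
open import Data.Fin using (Fin; zero; suc; _≟_; toℕ; inject₁; fromℕ; lower₁)
import Data.Fin.Properties as Fin
open import Data.Fin.Properties using (any?; toℕ-fromℕ; inject₁-lower₁)
open import Data.List using (List; []; _∷_; length; filter; tabulate)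
open import Data.List.Relation.Unary.All using (All; []; _∷_)
open import Data.Maybe using (Maybe; just; nothing; fromMaybe)
import Data.Maybe as Maybe
open import Data.Nat using (ℕ; zero; suc; _+_; _*_; _≤_; _<_; z≤n; s≤s; s≤s⁻¹)
open import Data.Nat.Properties hiding (_≟_)
open import Algebra.Properties.CommutativeSemigroup +-commutativeSemigroup
  using (interchange; xy∙z≈zy∙x)
open import Data.Product using (Σ; _×_; _,_; proj₁; proj₂; ∃; ∃₂; uncurry)
open import Data.Sum using (_⊎_; inj₁; inj₂; [_,_]′)
open import Data.Vec using (Vec; []; _∷_; lookup; _∷ʳ_)
open import Data.Vec.Functional using (updateAt)
open import Data.Vec.Functional.Properties using (updateAt-updates; updateAt-minimal)
open import Function using (_∘_; const; flip)
open import Function.Bundles using (Equivalence; _⇔_; mk⇔)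
open import Relation.Binary.PropositionalEquality
open import Relation.Nullary using (¬_; does; yes; no; contradiction)
open import Relation.Nullary.Decidable using (dec-true; dec-false; ¬?; _×-dec_)

-- Counting over Fin

bit : Bool → ℕ
bit false = 0
bit true  = 1

bit≤1 : ∀ b → bit b ≤ 1
bit≤1 false = z≤n
bit≤1 true  = s≤s z≤n

bit-mono : ∀ {a b} → (a ≡ true → b ≡ true) → bit a ≤ bit b
bit-mono {false} _   = z≤n
bit-mono {true}  a⇒b rewrite a⇒b refl = s≤s z≤n

count : ∀ {m} → (Fin m → Bool) → ℕ
count {zero}  f = 0
count {suc m} f = bit (f zero) + count (f ∘ suc)

count-cong : ∀ {m} {f g : Fin m → Bool} → (∀ i → f i ≡ g i) → count f ≡ count g
count-cong {zero}  eq = refl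
count-cong {suc m} eq = cong₂ _+_ (cong bit (eq zero)) (count-cong (eq ∘ suc))

count-pointwise : ∀ {m} {f g h k : Fin m → Bool} →
  (∀ i → bit (f i) + bit (g i) ≡ bit (h i) + bit (k i)) →
  count f + count g ≡ count h + count k
count-pointwise {zero}  eq = refl
count-pointwise {suc m} {f} {g} {h} {k} eq = begin
  (bit (f zero) + count (f ∘ suc)) + (bit (g zero) + count (g ∘ suc))
    ≡⟨ interchange (bit (f zero)) _ _ _ ⟩
  (bit (f zero) + bit (g zero)) + (count (f ∘ suc) + count (g ∘ suc))
    ≡⟨ cong₂ _+_ (eq zero) (count-pointwise (eq ∘ suc)) ⟩
  (bit (h zero) + bit (k zero)) + (count (h ∘ suc) + count (k ∘ suc))
    ≡⟨ interchange (bit (h zero)) _ _ _ ⟩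
  (bit (h zero) + count (h ∘ suc)) + (bit (k zero) + count (k ∘ suc)) ∎
  where open ≡-Reasoning

count-updateAt : ∀ {m} (f : Fin m → Bool) a (g : Bool → Bool) →
  count (updateAt f a g) + bit (f a) ≡ count f + bit (g (f a))
count-updateAt {suc m} f zero    g = xy∙z≈zy∙x (bit (g (f zero))) (count (f ∘ suc)) (bit (f zero))
count-updateAt {suc m} f (suc a) g = begin
  bit (f zero) + count (updateAt (f ∘ suc) a g) + bit (f (suc a))
    ≡⟨ +-assoc (bit (f zero)) _ _ ⟩
  bit (f zero) + (count (updateAt (f ∘ suc) a g) + bit (f (suc a)))
    ≡⟨ cong (bit (f zero) +_) (count-updateAt (f ∘ suc) a g) ⟩
  bit (f zero) + (count (f ∘ suc) + bit (g (f (suc a))))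
    ≡⟨ +-assoc (bit (f zero)) _ _ ⟨
  bit (f zero) + count (f ∘ suc) + bit (g (f (suc a))) ∎
  where open ≡-Reasoning

count-false : ∀ {m} {f : Fin m → Bool} → (∀ i → f i ≡ false) → count f ≡ 0
count-false {zero}  eq = refl
count-false {suc m} eq = cong₂ _+_ (cong bit (eq zero)) (count-false (eq ∘ suc))

count-≤ : ∀ {m} (f : Fin m → Bool) → count f ≤ m
count-≤ {zero}  f = z≤n
count-≤ {suc m} f = +-mono-≤ (bit≤1 (f zero)) (count-≤ (f ∘ suc))

count-mono : ∀ {m} {f g : Fin m → Bool} →
  (∀ i → f i ≡ true → g i ≡ true) → count f ≤ count g
count-mono {zero}  f⇒g = z≤n
count-mono {suc m} f⇒g = +-mono-≤ (bit-mono (f⇒g zero)) (count-mono (f⇒g ∘ suc))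

count-< : ∀ {m} {f g : Fin m → Bool} → (∀ i → f i ≡ true → g i ≡ true) →
  ∀ a → f a ≡ false → g a ≡ true → count f < count g
count-< {suc m} f⇒g zero    fa ga rewrite fa | ga = s≤s (count-mono (f⇒g ∘ suc))
count-< {suc m} {f} {g} f⇒g (suc a) fa ga =
  ≤-trans (≤-reflexive (sym (+-suc (bit (f zero)) _)))
          (+-mono-≤ (bit-mono (f⇒g zero)) (count-< (f⇒g ∘ suc) a fa ga))

count-true : ∀ {m} (f : Fin m → Bool) {a} → f a ≡ true → 0 < count f
count-true f {zero}  fa rewrite fa = s≤s z≤n
count-true f {suc a} fa = ≤-trans (count-true (f ∘ suc) fa) (m≤n+m _ (bit (f zero)))

count≡0⇒false : ∀ {m} (f : Fin m → Bool) → count f ≡ 0 → ∀ i → f i ≡ false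
count≡0⇒false f none i with f i in fi
... | false = refl
... | true with () ← subst (0 <_) none (count-true f fi)

count-pos : ∀ {m} (f : Fin m → Bool) → 0 < count f → ∃ λ i → f i ≡ true
count-pos {suc m} f pos with f zero in fzero
... | true  = zero , fzero
... | false = let i , fi = count-pos (f ∘ suc) pos in suc i , fi

count-≥2 : ∀ {m} (f : Fin m → Bool) → 2 ≤ count f → ∀ a → ∃ λ i → i ≢ a × f i ≡ true
count-≥2 f two a = i , i≢a , trans (sym (updateAt-minimal i a f i≢a)) gi
  where
  g = updateAt f a (const false)
  g-pos : 0 < count g
  g-pos = +-cancelʳ-≤ 1 1 (count g) (begin
    2                        ≤⟨ two ⟩
    count f                  ≡⟨ +-identityʳ _ ⟨
    count f + 0              ≡⟨ count-updateAt f a (const false) ⟨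
    count g + bit (f a)      ≤⟨ +-monoʳ-≤ (count g) (bit≤1 (f a)) ⟩
    count g + 1              ∎)
    where open ≤-Reasoning
  i = proj₁ (count-pos g g-pos)
  gi = proj₂ (count-pos g g-pos)
  i≢a : i ≢ a
  i≢a i≡a with () ← trans (sym (updateAt-updates a f)) (subst (λ k → g k ≡ true) i≡a gi)

count-∧-≟ : ∀ {m} (f : Fin m → Bool) p → count (λ j → f j ∧ does (j ≟ p)) ≡ bit (f p)
count-∧-≟ {suc m} f zero =
  trans (cong₂ _+_ (cong bit (∧-identityʳ (f zero))) (count-false (λ j → ∧-zeroʳ (f (suc j)))))
        (+-identityʳ _)
count-∧-≟ {suc m} f (suc p) = cong₂ _+_ (cong bit (∧-zeroʳ (f zero))) (count-∧-≟ (f ∘ suc) p)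

pair : ∀ {m} → Fin m → Fin m → Fin m → Bool
pair p q j = does (j ≟ p) ∨ does (j ≟ q)

pair-here : ∀ {m} (p q : Fin m) → pair p q p ≡ true
pair-here p q rewrite dec-true (p ≟ p) refl = refl

pair-true : ∀ {m} {p q j : Fin m} → pair p q j ≡ true → j ≡ p ⊎ j ≡ q
pair-true {p = p} {q} {j} e with j ≟ p | j ≟ q
... | yes j≡p | _       = inj₁ j≡p
... | no _    | yes j≡q = inj₂ j≡q

count-∧-pair : ∀ {m} (f : Fin m → Bool) {p q} → p ≢ q →
  count (λ j → f j ∧ pair p q j) ≡ bit (f p) + bit (f q)
count-∧-pair {m} f {p} {q} p≢q = begin
  count f∧pq                            ≡⟨ +-identityʳ _ ⟨
  count f∧pq + 0                        ≡⟨ cong (count f∧pq +_) (count-false {m} (λ _ → refl)) ⟨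
  count f∧pq + count {m} (λ _ → false)  ≡⟨ count-pointwise split ⟩
  count (f∧≟ p) + count (f∧≟ q)         ≡⟨ cong₂ _+_ (count-∧-≟ f p) (count-∧-≟ f q) ⟩
  bit (f p) + bit (f q)                 ∎
  where
  open ≡-Reasoning
  f∧pq = λ j → f j ∧ pair p q j
  f∧≟ = λ r j → f j ∧ does (j ≟ r)
  split : ∀ j → bit (f∧pq j) + bit false ≡ bit (f∧≟ p j) + bit (f∧≟ q j)
  split j with f j | j ≟ p | j ≟ q
  ... | _     | yes refl | yes refl = contradiction refl p≢q
  ... | false | _        | _        = refl
  ... | true  | yes _    | no _     = refl
  ... | true  | no _     | yes _    = refl
  ... | true  | no _     | no _     = refl

count-inject₁ : ∀ {n} (f : Fin (suc n) → Bool) → count f ≡ count (f ∘ inject₁) + bit (f (fromℕ n))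
count-inject₁ {zero}  f = +-comm (bit (f zero)) 0
count-inject₁ {suc n} f =
  trans (cong (bit (f zero) +_) (count-inject₁ (f ∘ suc))) (sym (+-assoc (bit (f zero)) _ _))

sum : ∀ {m} → (Fin m → ℕ) → ℕ
sum {zero}  F = 0
sum {suc m} F = F zero + sum (F ∘ suc)

sum-cong : ∀ {m} {F G : Fin m → ℕ} → (∀ i → F i ≡ G i) → sum F ≡ sum G
sum-cong {zero}  eq = refl
sum-cong {suc m} eq = cong₂ _+_ (eq zero) (sum-cong (eq ∘ suc))

sum-mono : ∀ {m} {F G : Fin m → ℕ} → (∀ i → F i ≤ G i) → sum F ≤ sum G
sum-mono {zero}  le = z≤n
sum-mono {suc m} le = +-mono-≤ (le zero) (sum-mono (le ∘ suc))

sum-< : ∀ {m} {F G : Fin m → ℕ} → (∀ i → F i ≤ G i) → ∀ a → F a < G a → sum F < sum G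
sum-< {suc m} le zero    lt = +-mono-<-≤ lt (sum-mono (le ∘ suc))
sum-< {suc m} le (suc a) lt = +-mono-≤-< (le zero) (sum-< (le ∘ suc) a lt)

degree≡count : ∀ {n} (G : SimpleGraph n) u → degree G u ≡ count (adj G u)
degree≡count {n} G u = filter-tabulate n (λ i → i)
  where
  filter-tabulate : ∀ m (e : Fin m → Fin n) →
    length (filter (λ w → T? (adj G u w)) (tabulate e)) ≡ count (adj G u ∘ e)
  filter-tabulate zero    e = refl
  filter-tabulate (suc m) e with adj G u (e zero)
  ... | true  = cong suc (filter-tabulate m (e ∘ suc))
  ... | false = filter-tabulate m (e ∘ suc)

-- Toggling edges

module _ {n : ℕ} where

  _⊕_ : SimpleGraph n → SimpleGraph n → SimpleGraph n
  G ⊕ H = record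
    { adj    = λ i j → adj G i j xor adj H i j
    ; sym    = λ i j → cong₂ _xor_ (SimpleGraph.sym G i j) (SimpleGraph.sym H i j)
    ; irrefl = λ i → cong₂ _xor_ (irrefl G i) (irrefl H i)
    }

  _∖_ : SimpleGraph n → SimpleGraph n → SimpleGraph n
  G ∖ H = record
    { adj    = λ i j → adj G i j ∧ not (adj H i j)
    ; sym    = λ i j → cong₂ (λ a b → a ∧ not b) (SimpleGraph.sym G i j) (SimpleGraph.sym H i j)
    ; irrefl = λ i → cong (λ a → a ∧ not (adj H i i)) (irrefl G i)
    }

  _⊆_ : SimpleGraph n → SimpleGraph n → Set
  G ⊆ H = ∀ i j → adj G i j ≡ true → adj H i j ≡ true

  deg : SimpleGraph n → Fin n → ℕ
  deg G u = count (adj G u)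

  size : SimpleGraph n → ℕ
  size G = sum (deg G)

  Isolated : SimpleGraph n → Fin n → Set
  Isolated G u = ∀ j → adj G u j ≡ false

  StarAt : Fin n → SimpleGraph n → Set
  StarAt c K = ∀ x y → x ≢ c → y ≢ c → adj K x y ≡ false

  Neighbours : SimpleGraph n → Fin n → Fin n → Fin n → Set
  Neighbours C u p q = ∀ j → adj C u j ≡ pair p q j

  adj-sym : ∀ (G : SimpleGraph n) {i j b} → adj G i j ≡ b → adj G j i ≡ b
  adj-sym G e = trans (SimpleGraph.sym G _ _) e

  adj⇒≢ : ∀ (G : SimpleGraph n) {i j} → adj G i j ≡ true → i ≢ j
  adj⇒≢ G {i} e refl with () ← trans (sym (irrefl G i)) e

  edge-avoids-isolatedˡ : ∀ {G : SimpleGraph n} {u i j} → Isolated G u → adj G i j ≡ true → i ≢ u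
  edge-avoids-isolatedˡ iso e refl with () ← trans (sym (iso _)) e

  edge-avoids-isolatedʳ : ∀ {G : SimpleGraph n} {u i j} → Isolated G u → adj G i j ≡ true → j ≢ u
  edge-avoids-isolatedʳ {G} iso e = edge-avoids-isolatedˡ {G} iso (adj-sym G e)

  ⊕-off : ∀ (K C : SimpleGraph n) {i j} → adj C i j ≡ false → adj (K ⊕ C) i j ≡ adj K i j
  ⊕-off K C {i} {j} e = trans (cong (adj K i j xor_) e) (xor-identityʳ _)

  size-cong : ∀ (K L : SimpleGraph n) → (∀ i j → adj K i j ≡ adj L i j) → size K ≡ size L
  size-cong K L eq = sum-cong (λ i → count-cong (eq i))

  size-⊕ˡ : ∀ (G H C : SimpleGraph n) → size ((G ⊕ C) ⊕ H) ≡ size ((G ⊕ H) ⊕ C)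
  size-⊕ˡ G H C = size-cong ((G ⊕ C) ⊕ H) ((G ⊕ H) ⊕ C) λ i j → begin
    (adj G i j xor adj C i j) xor adj H i j  ≡⟨ xor-assoc (adj G i j) _ _ ⟩
    adj G i j xor (adj C i j xor adj H i j)  ≡⟨ cong (adj G i j xor_) (xor-comm (adj C i j) _) ⟩
    adj G i j xor (adj H i j xor adj C i j)  ≡⟨ xor-assoc (adj G i j) _ _ ⟨
    (adj G i j xor adj H i j) xor adj C i j  ∎
    where open ≡-Reasoning

  size-⊕ʳ : ∀ (G H C : SimpleGraph n) → size (G ⊕ (H ⊕ C)) ≡ size ((G ⊕ H) ⊕ C)
  size-⊕ʳ G H C = size-cong (G ⊕ (H ⊕ C)) ((G ⊕ H) ⊕ C) λ i j → sym (xor-assoc (adj G i j) _ _)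

  ∖-true : ∀ (G H : SimpleGraph n) {i j} →
    adj (G ∖ H) i j ≡ true → adj G i j ≡ true × adj H i j ≡ false
  ∖-true G H {i} {j} e with adj G i j | adj H i j
  ... | true | false = refl , refl

  ∖-intro : ∀ (G H : SimpleGraph n) {i j} →
    adj G i j ≡ true → adj H i j ≡ false → adj (G ∖ H) i j ≡ true
  ∖-intro G H g h rewrite g | h = refl

  ∖-absentˡ : ∀ (G H : SimpleGraph n) {i j} → adj G i j ≡ false → adj (G ∖ H) i j ≡ false
  ∖-absentˡ G H g rewrite g = refl

  ∖-absentʳ : ∀ (G H : SimpleGraph n) {i j} → adj H i j ≡ true → adj (G ∖ H) i j ≡ false
  ∖-absentʳ G H {i} {j} h rewrite h = ∧-zeroʳ (adj G i j)

  ∖-false : ∀ (G H : SimpleGraph n) {i j} →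
    adj (G ∖ H) i j ≡ false → adj G i j ≡ true → adj H i j ≡ true
  ∖-false G H e g rewrite g = trans (sym (not-involutive _)) (cong not e)

  ∖-⊆ : ∀ (G H : SimpleGraph n) → (G ∖ H) ⊆ G
  ∖-⊆ G H i j e = proj₁ (∖-true G H e)

  ∖⇒⊕ : ∀ (G H : SimpleGraph n) {i j} → adj (G ∖ H) i j ≡ true → adj (G ⊕ H) i j ≡ true
  ∖⇒⊕ G H {i} {j} e with adj G i j | adj H i j
  ... | true | false = refl

  ∖⇒⊕ʳ : ∀ (G H : SimpleGraph n) {i j} → adj (H ∖ G) i j ≡ true → adj (G ⊕ H) i j ≡ true
  ∖⇒⊕ʳ G H {i} {j} e = trans (xor-comm (adj G i j) _) (∖⇒⊕ H G e)

  ∖-balanced : ∀ (G H : SimpleGraph n) u → deg G u ≡ deg H u → deg (G ∖ H) u ≡ deg (H ∖ G) u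
  ∖-balanced G H u eq = +-cancelˡ-≡ (deg G u) _ _ (begin
    deg G u + deg (G ∖ H) u  ≡⟨ cong (_+ deg (G ∖ H) u) eq ⟩
    deg H u + deg (G ∖ H) u  ≡⟨ count-pointwise split ⟨
    deg G u + deg (H ∖ G) u  ∎)
    where
    open ≡-Reasoning
    split : ∀ j → bit (adj G u j) + bit (adj (H ∖ G) u j) ≡ bit (adj H u j) + bit (adj (G ∖ H) u j)
    split j with adj G u j | adj H u j
    ... | false | false = refl
    ... | false | true  = refl
    ... | true  | false = refl
    ... | true  | true  = refl

  ∖-edge-swap : ∀ (G H : SimpleGraph n) u → deg G u ≡ deg H u →
    ∀ {w} → adj (H ∖ G) u w ≡ true → ∃ λ z → adj (G ∖ H) u z ≡ true
  ∖-edge-swap G H u eq uw =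
    count-pos (adj (G ∖ H) u) (subst (0 <_) (sym (∖-balanced G H u eq)) (count-true (adj (H ∖ G) u) uw))

  deg-⊕ : ∀ (K C : SimpleGraph n) u →
    deg (K ⊕ C) u + count (λ j → adj K u j ∧ adj C u j) ≡
    deg K u + count (λ j → not (adj K u j) ∧ adj C u j)
  deg-⊕ K C u = count-pointwise split
    where
    split : ∀ j → bit (adj (K ⊕ C) u j) + bit (adj K u j ∧ adj C u j) ≡
                  bit (adj K u j) + bit (not (adj K u j) ∧ adj C u j)
    split j with adj K u j | adj C u j
    ... | false | false = refl
    ... | false | true  = refl
    ... | true  | false = refl
    ... | true  | true  = refl

  deg-⊕-isolated : ∀ (K C : SimpleGraph n) {u} → Isolated C u → deg (K ⊕ C) u ≡ deg K u
  deg-⊕-isolated K C {u} iso = count-cong (λ j → ⊕-off K C (iso j))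

  deg-⊕-pair : ∀ (K C : SimpleGraph n) {u p q} → Neighbours C u p q → p ≢ q →
    deg (K ⊕ C) u + (bit (adj K u p) + bit (adj K u q)) ≡
    deg K u + (bit (not (adj K u p)) + bit (not (adj K u q)))
  deg-⊕-pair K C {u} {p} {q} nb p≢q = begin
    deg (K ⊕ C) u + (bit (adj K u p) + bit (adj K u q))
      ≡⟨ cong (deg (K ⊕ C) u +_) (on-pair (adj K u)) ⟨
    deg (K ⊕ C) u + count (λ j → adj K u j ∧ adj C u j)
      ≡⟨ deg-⊕ K C u ⟩
    deg K u + count (λ j → not (adj K u j) ∧ adj C u j)
      ≡⟨ cong (deg K u +_) (on-pair (not ∘ adj K u)) ⟩
    deg K u + (bit (not (adj K u p)) + bit (not (adj K u q))) ∎
    where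
    open ≡-Reasoning
    on-pair : ∀ f → count (λ j → f j ∧ adj C u j) ≡ bit (f p) + bit (f q)
    on-pair f = trans (count-cong (λ j → cong (f j ∧_) (nb j))) (count-∧-pair f p≢q)

  module _ (K C : SimpleGraph n) {u p q : Fin n} (nb : Neighbours C u p q) (p≢q : p ≢ q) where

    private
      pair-identity : ∀ {a b} → adj K u p ≡ a → adj K u q ≡ b →
        deg (K ⊕ C) u + (bit a + bit b) ≡ deg K u + (bit (not a) + bit (not b))
      pair-identity refl refl = deg-⊕-pair K C nb p≢q

    deg-⊕-exchange : adj K u p ≡ true → adj K u q ≡ false → deg (K ⊕ C) u ≡ deg K u
    deg-⊕-exchange up uq = +-cancelʳ-≡ 1 _ _ (pair-identity up uq)

    deg-⊕-loses₂ : adj K u p ≡ true → adj K u q ≡ true → deg (K ⊕ C) u + 2 ≡ deg K u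
    deg-⊕-loses₂ up uq = trans (pair-identity up uq) (+-identityʳ _)

    deg-⊕-gains₂ : adj K u p ≡ false → adj K u q ≡ false → deg (K ⊕ C) u ≡ deg K u + 2
    deg-⊕-gains₂ up uq = trans (sym (+-identityʳ _)) (pair-identity up uq)

    deg-⊕-≤ : adj K u p ≡ true ⊎ adj K u q ≡ true → deg (K ⊕ C) u ≤ deg K u
    deg-⊕-≤ one with adj K u p in up | adj K u q in uq | one
    ... | true  | true  | _       = ≤-trans (m≤m+n _ 2) (≤-reflexive (deg-⊕-loses₂ up uq))
    ... | true  | false | _       = ≤-reflexive (deg-⊕-exchange up uq)
    ... | false | true  | _       = ≤-reflexive (+-cancelʳ-≡ 1 _ _ (pair-identity up uq))
    ... | false | false | inj₁ ()
    ... | false | false | inj₂ ()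

  deg-<-by-absorption : ∀ (R : SimpleGraph n) {x w y} → x ≢ w → y ≢ x →
    adj R w y ≡ true → adj R x y ≡ false →
    (∀ z → adj R x z ≡ true → z ≢ w → adj R z w ≡ true) → deg R x < deg R w
  deg-<-by-absorption R {x} {w} {y} x≢w y≢x wy xy absorbed =
    subst (_< deg R w) count-P (count-< P⊆w y Py wy)
    where
    -- P is the neighbourhood of x with its entry at w moved to x; it fits inside that of w.
    A = adj R x
    P₁ = updateAt A x (const (A w))
    P = updateAt P₁ w (const false)
    count-P : count P ≡ count A
    count-P = +-cancelʳ-≡ (bit (A w)) _ _ (begin
      count P + bit (A w)    ≡⟨ cong (λ b → count P + bit b) (updateAt-minimal w x A (≢-sym x≢w)) ⟨
      count P + bit (P₁ w)   ≡⟨ count-updateAt P₁ w (const false) ⟩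
      count P₁ + 0           ≡⟨ cong (λ b → count P₁ + bit b) (irrefl R x) ⟨
      count P₁ + bit (A x)   ≡⟨ count-updateAt A x (const (A w)) ⟩
      count A + bit (A w)    ∎)
      where open ≡-Reasoning
    P⊆w : ∀ i → P i ≡ true → adj R w i ≡ true
    P⊆w i Pi with i ≟ w | i ≟ x
    ... | yes refl | _        with () ← trans (sym (updateAt-updates w P₁)) Pi
    ... | no i≢w   | yes refl =
      adj-sym R (trans (sym (updateAt-updates x A)) (trans (sym (updateAt-minimal x w P₁ i≢w)) Pi))
    ... | no i≢w   | no i≢x   =
      adj-sym R (absorbed i (trans (sym (updateAt-minimal i x A i≢x))
                                   (trans (sym (updateAt-minimal i w P₁ i≢w)) Pi)) i≢w)
    Py : P y ≡ false
    Py = trans (updateAt-minimal y w P₁ (adj⇒≢ R wy ∘ sym)) (trans (updateAt-minimal y x A y≢x) xy)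

-- Triangles and 4-cycles

  link : Fin n → Fin n → Fin n → Fin n → Bool
  link a b i j = does (i ≟ a) ∧ does (j ≟ b) ∨ does (i ≟ b) ∧ does (j ≟ a)

  link-sym : ∀ a b i j → link a b i j ≡ link a b j i
  link-sym a b i j = trans (∨-comm (does (i ≟ a) ∧ does (j ≟ b)) _)
                           (cong₂ _∨_ (∧-comm (does (i ≟ b)) _) (∧-comm (does (i ≟ a)) _))

  link-irrefl : ∀ {a b} → a ≢ b → ∀ i → link a b i i ≡ false
  link-irrefl {a} {b} a≢b i with i ≟ a | i ≟ b
  ... | yes refl | yes refl = contradiction refl a≢b
  ... | yes _    | no _     = refl
  ... | no _     | yes _    = refl
  ... | no _     | no _     = refl

  link-here : ∀ {a b} → a ≢ b → ∀ j → link a b a j ≡ does (j ≟ b)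
  link-here {a} {b} a≢b j rewrite dec-true (a ≟ a) refl | dec-false (a ≟ b) a≢b = ∨-identityʳ _

  link-there : ∀ {a b} → a ≢ b → ∀ j → link a b b j ≡ does (j ≟ a)
  link-there {a} {b} a≢b j rewrite dec-false (b ≟ a) (≢-sym a≢b) | dec-true (b ≟ b) refl = refl

  link-away : ∀ {a b i} → i ≢ a → i ≢ b → ∀ j → link a b i j ≡ false
  link-away {a} {b} {i} i≢a i≢b j rewrite dec-false (i ≟ a) i≢a | dec-false (i ≟ b) i≢b = refl

  linked : List (Fin n × Fin n) → Fin n → Fin n → Bool
  linked []             i j = false
  linked ((a , b) ∷ es) i j = link a b i j ∨ linked es i j

  fromEdges : (es : List (Fin n × Fin n)) → All (uncurry _≢_) es → SimpleGraph n
  fromEdges es distinct = record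
    { adj    = linked es
    ; sym    = linked-sym es
    ; irrefl = linked-irrefl distinct
    }
    where
    linked-sym : ∀ es i j → linked es i j ≡ linked es j i
    linked-sym []             i j = refl
    linked-sym ((a , b) ∷ es) i j = cong₂ _∨_ (link-sym a b i j) (linked-sym es i j)
    linked-irrefl : ∀ {es} → All (uncurry _≢_) es → ∀ i → linked es i i ≡ false
    linked-irrefl []               i = refl
    linked-irrefl (a≢b ∷ distinct) i = cong₂ _∨_ (link-irrefl a≢b i) (linked-irrefl distinct i)

  module Triangle {a b c : Fin n} (a≢b : a ≢ b) (a≢c : a ≢ c) (b≢c : b ≢ c) where

    private
      b≢a = ≢-sym a≢b
      c≢a = ≢-sym a≢c
      c≢b = ≢-sym b≢c

    triangle : SimpleGraph n
    triangle = fromEdges ((a , b) ∷ (b , c) ∷ (c , a) ∷ []) (a≢b ∷ b≢c ∷ c≢a ∷ [])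

    triangle-a : Neighbours triangle a b c
    triangle-a j rewrite link-here a≢b j | link-away a≢b a≢c j | link-there c≢a j =
      cong (does (j ≟ b) ∨_) (∨-identityʳ _)

    triangle-b : Neighbours triangle b a c
    triangle-b j rewrite link-there a≢b j | link-here b≢c j | link-away b≢c b≢a j =
      cong (does (j ≟ a) ∨_) (∨-identityʳ _)

    triangle-c : Neighbours triangle c a b
    triangle-c j rewrite link-away c≢a c≢b j | link-there b≢c j | link-here c≢a j =
      trans (cong (does (j ≟ b) ∨_) (∨-identityʳ _)) (∨-comm (does (j ≟ b)) _)

    triangle-outside : ∀ {u} → u ≢ a → u ≢ b → u ≢ c → Isolated triangle u
    triangle-outside u≢a u≢b u≢c j
      rewrite link-away u≢a u≢b j | link-away u≢b u≢c j | link-away u≢c u≢a j = refl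

    triangle-elim : (P : Fin n → Set) → P a → P b → P c →
      (∀ u → Isolated triangle u → P u) → ∀ u → P u
    triangle-elim P pa pb pc po u with u ≟ a | u ≟ b | u ≟ c
    ... | yes refl | _        | _        = pa
    ... | no _     | yes refl | _        = pb
    ... | no _     | no _     | yes refl = pc
    ... | no u≢a   | no u≢b   | no u≢c   = po u (triangle-outside u≢a u≢b u≢c)

    triangle-avoiding-a : ∀ {x y} → adj triangle x y ≡ true → x ≢ a → y ≢ a →
      (x ≡ b × y ≡ c) ⊎ (x ≡ c × y ≡ b)
    triangle-avoiding-a {x} {y} e x≢a y≢a = triangle-elim P
      (λ _ a≢a → contradiction refl a≢a)
      (λ e _ → [ flip contradiction y≢a , inj₁ ∘ (refl ,_) ]′ (pair-true (trans (sym (triangle-b y)) e)))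
      (λ e _ → [ flip contradiction y≢a , inj₂ ∘ (refl ,_) ]′ (pair-true (trans (sym (triangle-c y)) e)))
      (λ _ iso e _ → contradiction (trans (sym (iso y)) e) λ ())
      x e x≢a
      where
      P : Fin n → Set
      P x = adj triangle x y ≡ true → x ≢ a → (x ≡ b × y ≡ c) ⊎ (x ≡ c × y ≡ b)

  module Square {a b c d : Fin n} (a≢b : a ≢ b) (a≢c : a ≢ c) (a≢d : a ≢ d)
                (b≢c : b ≢ c) (b≢d : b ≢ d) (c≢d : c ≢ d) where

    private
      b≢a = ≢-sym a≢b
      c≢a = ≢-sym a≢c
      d≢a = ≢-sym a≢d
      c≢b = ≢-sym b≢c
      d≢b = ≢-sym b≢d
      d≢c = ≢-sym c≢d

    square : SimpleGraph n
    square = fromEdges ((a , b) ∷ (b , c) ∷ (c , d) ∷ (d , a) ∷ [])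
                       (a≢b ∷ b≢c ∷ c≢d ∷ d≢a ∷ [])

    square-a : Neighbours square a b d
    square-a j
      rewrite link-here a≢b j | link-away a≢b a≢c j | link-away a≢c a≢d j | link-there d≢a j
      = cong (does (j ≟ b) ∨_) (∨-identityʳ _)

    square-b : Neighbours square b a c
    square-b j
      rewrite link-there a≢b j | link-here b≢c j | link-away b≢c b≢d j | link-away b≢d b≢a j
      = cong (does (j ≟ a) ∨_) (∨-identityʳ _)

    square-c : Neighbours square c d b
    square-c j
      rewrite link-away c≢a c≢b j | link-there b≢c j | link-here c≢d j | link-away c≢d c≢a j
      = trans (cong (does (j ≟ b) ∨_) (∨-identityʳ _)) (∨-comm (does (j ≟ b)) _)

    square-d : Neighbours square d c a
    square-d j
      rewrite link-away d≢a d≢b j | link-away d≢b d≢c j | link-there c≢d j | link-here d≢a j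
      = cong (does (j ≟ c) ∨_) (∨-identityʳ _)

    square-outside : ∀ {u} → u ≢ a → u ≢ b → u ≢ c → u ≢ d → Isolated square u
    square-outside u≢a u≢b u≢c u≢d j
      rewrite link-away u≢a u≢b j | link-away u≢b u≢c j | link-away u≢c u≢d j | link-away u≢d u≢a j
      = refl

    square-elim : (P : Fin n → Set) → P a → P b → P c → P d →
      (∀ u → Isolated square u → P u) → ∀ u → P u
    square-elim P pa pb pc pd po u with u ≟ a | u ≟ b | u ≟ c | u ≟ d
    ... | yes refl | _        | _        | _        = pa
    ... | no _     | yes refl | _        | _        = pb
    ... | no _     | no _     | yes refl | _        = pc
    ... | no _     | no _     | no _     | yes refl = pd
    ... | no u≢a   | no u≢b   | no u≢c   | no u≢d   = po u (square-outside u≢a u≢b u≢c u≢d)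

    deg-⊕-square : ∀ K → adj K a b ≡ true → adj K b c ≡ false →
      adj K c d ≡ true → adj K d a ≡ false → ∀ u → deg (K ⊕ square) u ≡ deg K u
    deg-⊕-square K ab bc cd da = square-elim (λ u → deg (K ⊕ square) u ≡ deg K u)
      (deg-⊕-exchange K square square-a b≢d ab (adj-sym K da))
      (deg-⊕-exchange K square square-b a≢c (adj-sym K ab) bc)
      (deg-⊕-exchange K square square-c d≢b cd (adj-sym K bc))
      (deg-⊕-exchange K square square-d c≢a (adj-sym K cd) da)
      (λ _ iso → deg-⊕-isolated K square iso)

    size-⊕-square : ∀ D → adj D a b ≡ true → adj D d a ≡ true →
      adj D b c ≡ true ⊎ adj D c d ≡ true → size (D ⊕ square) < size D
    size-⊕-square D ab da bc⊎cd =
      sum-< shrinks a (≤-trans (m<m+n _ (s≤s z≤n)) (≤-reflexive loses₂))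
      where
      loses₂ = deg-⊕-loses₂ D square square-a b≢d ab (adj-sym D da)
      shrinks : ∀ u → deg (D ⊕ square) u ≤ deg D u
      shrinks = square-elim (λ u → deg (D ⊕ square) u ≤ deg D u)
        (deg-⊕-≤ D square square-a b≢d (inj₁ ab))
        (deg-⊕-≤ D square square-b a≢c (inj₁ (adj-sym D ab)))
        (deg-⊕-≤ D square square-c d≢b ([ inj₂ ∘ adj-sym D , inj₁ ]′ bc⊎cd))
        (deg-⊕-≤ D square square-d c≢a (inj₂ da))
        (λ _ iso → ≤-reflexive (deg-⊕-isolated D square iso))

-- Matchings

  Covers : ∀ {G : SimpleGraph n} {k} → Matching G k → Fin n → Set
  Covers M u = ∃ λ a → u ≡ proj₁ (Matching.edge M a) ⊎ u ≡ proj₂ (Matching.edge M a)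

  module _ {G : SimpleGraph n} where

    matched-adj : ∀ {k} (M : Matching G k) a →
      adj G (proj₁ (Matching.edge M a)) (proj₂ (Matching.edge M a)) ≡ true
    matched-adj M a = Equivalence.to T-≡ (Matching.isEdge M a)

    isolated⇒uncovered : ∀ {k u} (M : Matching G k) → Isolated G u → ¬ Covers M u
    isolated⇒uncovered M iso (a , inj₁ refl) with () ← trans (sym (iso _)) (matched-adj M a)
    isolated⇒uncovered M iso (a , inj₂ refl) with () ← trans (sym (iso _)) (adj-sym G (matched-adj M a))

    Matching-mono : ∀ {H k} → G ⊆ H → Matching G k → Matching H k
    Matching-mono G⊆H M = record
      { edge     = edge
      ; isEdge   = λ a → Equivalence.from T-≡ (G⊆H _ _ (matched-adj M a))
      ; disjoint = disjoint
      }
      where open Matching M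

    tailᴹ : ∀ {k} → Matching G (suc k) → Matching G k
    tailᴹ M = record
      { edge     = edge ∘ suc
      ; isEdge   = isEdge ∘ suc
      ; disjoint = λ a b a≢b → disjoint (suc a) (suc b) (a≢b ∘ Fin.suc-injective)
      }
      where open Matching M

    tailᴹ-avoids-head : ∀ {k} (M : Matching G (suc k)) →
      let s , t = Matching.edge M zero in ¬ Covers (tailᴹ M) s × ¬ Covers (tailᴹ M) t
    tailᴹ-avoids-head M = s∉ , t∉
      where
      open Matching M
      apart = λ a → disjoint zero (suc a) λ ()
      s∉ : ¬ Covers (tailᴹ M) (proj₁ (edge zero))
      s∉ (a , inj₁ e) = proj₁ (apart a) e
      s∉ (a , inj₂ e) = proj₁ (proj₂ (apart a)) e
      t∉ : ¬ Covers (tailᴹ M) (proj₂ (edge zero))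
      t∉ (a , inj₁ e) = proj₁ (proj₂ (proj₂ (apart a))) e
      t∉ (a , inj₂ e) = proj₂ (proj₂ (proj₂ (apart a))) e

    consᴹ : ∀ {k s t} → adj G s t ≡ true → (M : Matching G k) →
      ¬ Covers M s → ¬ Covers M t → Matching G (suc k)
    consᴹ {k} {s} {t} st M s∉M t∉M =
      record { edge = edge′ ; isEdge = isEdge′ ; disjoint = disjoint′ }
      where
      open Matching M
      edge′ : Fin (suc k) → Fin n × Fin n
      edge′ zero    = s , t
      edge′ (suc a) = edge a
      isEdge′ : ∀ a → T (adj G (proj₁ (edge′ a)) (proj₂ (edge′ a)))
      isEdge′ zero    = Equivalence.from T-≡ st
      isEdge′ (suc a) = isEdge a
      avoids : ∀ {u} → ¬ Covers M u → ∀ b → (u ≢ proj₁ (edge b)) × (u ≢ proj₂ (edge b))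
      avoids u∉M b = (λ e → u∉M (b , inj₁ e)) , (λ e → u∉M (b , inj₂ e))
      disjoint′ : ∀ a b → a ≢ b →
        (proj₁ (edge′ a) ≢ proj₁ (edge′ b)) × (proj₁ (edge′ a) ≢ proj₂ (edge′ b)) ×
        (proj₂ (edge′ a) ≢ proj₁ (edge′ b)) × (proj₂ (edge′ a) ≢ proj₂ (edge′ b))
      disjoint′ zero    zero    0≢0 = contradiction refl 0≢0
      disjoint′ zero    (suc b) _   =
        let s₁ , s₂ = avoids s∉M b ; t₁ , t₂ = avoids t∉M b in s₁ , s₂ , t₁ , t₂
      disjoint′ (suc a) zero    _   =
        let s₁ , s₂ = avoids s∉M a ; t₁ , t₂ = avoids t∉M a in
        ≢-sym s₁ , ≢-sym t₁ , ≢-sym s₂ , ≢-sym t₂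
      disjoint′ (suc a) (suc b) a≢b = disjoint a b (a≢b ∘ cong suc)

  -- Edges of G ∖ H are called red, those of H ∖ G blue.
  record Switch (G H : SimpleGraph n) : Set where
    field
      x y z w : Fin n
      blue-xy : adj (H ∖ G) x y ≡ true
      red-xz  : adj (G ∖ H) x z ≡ true
      red-yw  : adj (G ∖ H) y w ≡ true
      z≢w     : z ≢ w
      red-zw  : adj (G ∖ H) z w ≡ false

    Gxz = proj₁ (∖-true G H red-xz)
    Hxz = proj₂ (∖-true G H red-xz)
    Gyw = proj₁ (∖-true G H red-yw)
    Hyw = proj₂ (∖-true G H red-yw)
    Hxy = proj₁ (∖-true H G blue-xy)
    Gxy = proj₂ (∖-true H G blue-xy)

    x≢y : x ≢ y
    x≢y = adj⇒≢ H Hxy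

    x≢z : x ≢ z
    x≢z = adj⇒≢ G Gxz

    y≢w : y ≢ w
    y≢w = adj⇒≢ G Gyw

    x≢w : x ≢ w
    x≢w x≡w with () ← trans (sym Gxy) (adj-sym G (subst (λ u → adj G y u ≡ true) (sym x≡w) Gyw))

    z≢y : z ≢ y
    z≢y z≡y with () ← trans (sym Gxy) (subst (λ u → adj G x u ≡ true) z≡y Gxz)

-- Realizations compared at an extra vertex

double-suc : ∀ k → 2 * suc k ≡ 2 * k + 2
double-suc k = trans (*-suc 2 k) (+-comm 2 _)

module _ {N : ℕ} (v : Fin N) where

  record Extends (k : ℕ) (G H : SimpleGraph N) : Set where
    field
      v-isolated : Isolated G v
      balanced   : ∀ u → u ≢ v → deg G u ≡ deg H u
      deg-v      : deg H v ≡ 2 * k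

  record Improvement (k : ℕ) (G H : SimpleGraph N) : Set where
    field
      G′ H′        : SimpleGraph N
      extends      : Extends k G′ H′
      same-degrees : ∀ u → deg G′ u ≡ deg G u
      smaller      : size (G′ ⊕ H′) < size (G ⊕ H)

  module _ {k : ℕ} {G H : SimpleGraph N} (ext : Extends k G H) where
    open Extends ext

    toggleˡ-extends : ∀ C → Isolated C v → (∀ u → deg (G ⊕ C) u ≡ deg G u) →
      Extends k (G ⊕ C) H
    toggleˡ-extends C C-v degrees = record
      { v-isolated = λ j → trans (⊕-off G C (C-v j)) (v-isolated j)
      ; balanced   = λ u u≢v → trans (degrees u) (balanced u u≢v)
      ; deg-v      = deg-v
      }

    toggleʳ-extends : ∀ C → (∀ u → deg (H ⊕ C) u ≡ deg H u) → Extends k G (H ⊕ C)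
    toggleʳ-extends C degrees = record
      { v-isolated = v-isolated
      ; balanced   = λ u u≢v → trans (balanced u u≢v) (sym (degrees u))
      ; deg-v      = trans (degrees v) deg-v
      }

    red-of-blue : ∀ {u w} → u ≢ v → adj (H ∖ G) u w ≡ true →
      ∃ λ z → adj (G ∖ H) u z ≡ true
    red-of-blue {u} u≢v = ∖-edge-swap G H u (balanced u u≢v)

    blue-of-red : ∀ {u w} → u ≢ v → adj (G ∖ H) u w ≡ true →
      ∃ λ z → adj (H ∖ G) u z ≡ true
    blue-of-red {u} u≢v = ∖-edge-swap H G u (sym (balanced u u≢v))

    red-isolated : StarAt v (H ∖ G) → ∀ {u} → u ≢ v → adj H u v ≡ false → Isolated (G ∖ H) u
    red-isolated star {u} u≢v Huv = count≡0⇒false (adj (G ∖ H) u)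
      (trans (∖-balanced G H u (balanced u u≢v)) (count-false no-blue))
      where
      no-blue : ∀ j → adj (H ∖ G) u j ≡ false
      no-blue j with j ≟ v
      ... | yes refl = ∖-absentˡ H G Huv
      ... | no j≢v   = star u j u≢v j≢v

    absorption-step : ∀ {x y w} → x ≢ v → adj (H ∖ G) x y ≡ true → adj (G ∖ H) y w ≡ true →
      (∀ z → adj (G ∖ H) x z ≡ true → z ≢ w → adj (G ∖ H) z w ≡ true) →
      deg (G ∖ H) x < deg (G ∖ H) w × w ≢ v × ∃ λ p → p ≢ v × adj (H ∖ G) w p ≡ true
    absorption-step {x} {y} {w} x≢v xy yw absorbed =
      x<w , w≢v , count-≥2 (adj (H ∖ G) w) two-blue v
      where
      Gxy = proj₂ (∖-true H G xy)
      Gyw = proj₁ (∖-true G H yw)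
      x≢w : x ≢ w
      x≢w refl with () ← trans (sym Gxy) (adj-sym G Gyw)
      x<w : deg (G ∖ H) x < deg (G ∖ H) w
      x<w = deg-<-by-absorption (G ∖ H) x≢w (≢-sym (adj⇒≢ (H ∖ G) xy))
                                (adj-sym (G ∖ H) yw) (∖-absentˡ G H Gxy) absorbed
      w≢v = edge-avoids-isolatedʳ {G = G} v-isolated Gyw
      two-blue : 2 ≤ deg (H ∖ G) w
      two-blue = begin
        2                     ≤⟨ s≤s (count-true (adj (G ∖ H) x) (proj₂ (red-of-blue x≢v xy))) ⟩
        suc (deg (G ∖ H) x)   ≤⟨ x<w ⟩
        deg (G ∖ H) w         ≡⟨ ∖-balanced G H w (balanced w w≢v) ⟩
        deg (H ∖ G) w         ∎
        where open ≤-Reasoning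

    -- Each unsuccessful round moves to a vertex of larger red degree, which is at most N.
    find-switch : ∀ fuel {x y} → x ≢ v → y ≢ v → adj (H ∖ G) x y ≡ true →
      N < deg (G ∖ H) x + fuel → Switch G H
    find-switch zero {x} _ _ _ N< =
      contradiction (≤-trans (≤-reflexive (+-identityʳ _)) (count-≤ (adj (G ∖ H) x))) (<⇒≱ N<)
    find-switch (suc fuel) {x} {y} x≢v y≢v xy N<
      with w , yw ← red-of-blue y≢v (adj-sym (H ∖ G) xy)
      with any? (λ z → (adj (G ∖ H) x z ≟ᵇ true) ×-dec ¬? (z ≟ w) ×-dec
                       (adj (G ∖ H) z w ≟ᵇ false))
    ... | yes (z , xz , z≢w , zw) = record
      { x = x ; y = y ; z = z ; w = w
      ; blue-xy = xy ; red-xz = xz ; red-yw = yw ; z≢w = z≢w ; red-zw = zw }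
    ... | no none
      with x<w , w≢v , p , p≢v , wp ←
             absorption-step x≢v xy yw (λ z xz z≢w → ¬-not (λ zw → none (z , xz , z≢w , zw)))
      = find-switch fuel w≢v p≢v wp (begin-strict
          N                            <⟨ N< ⟩
          deg (G ∖ H) x + suc fuel     ≡⟨ +-suc _ fuel ⟩
          suc (deg (G ∖ H) x) + fuel   ≤⟨ +-monoˡ-≤ fuel x<w ⟩
          deg (G ∖ H) w + fuel         ∎)
      where open ≤-Reasoning

    improve : Switch G H → Improvement k G H
    improve sw = by-zw (adj G z w) refl
      where
      open Switch sw
      v≢ˡ = λ {i j} (e : adj G i j ≡ true) → ≢-sym (edge-avoids-isolatedˡ {G = G} v-isolated e)
      v≢ʳ = λ {i j} (e : adj G i j ≡ true) → ≢-sym (edge-avoids-isolatedʳ {G = G} v-isolated e)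
      Dxz = ∖⇒⊕ G H red-xz
      Dxy = ∖⇒⊕ʳ G H blue-xy
      Dyw = ∖⇒⊕ G H red-yw
      by-zw : ∀ b → adj G z w ≡ b → Improvement k G H
      by-zw false Gzw = record
        { G′           = G ⊕ square
        ; H′           = H
        ; extends      = toggleˡ-extends square
                           (square-outside (v≢ˡ Gxz) (v≢ʳ Gxz) (v≢ʳ Gyw) (v≢ˡ Gyw)) degrees
        ; same-degrees = degrees
        ; smaller      = subst (_< size (G ⊕ H)) (sym (size-⊕ˡ G H square))
            (size-⊕-square (G ⊕ H) Dxz (adj-sym (G ⊕ H) Dxy) (inj₂ (adj-sym (G ⊕ H) Dyw)))
        }
        where
        open Square x≢z x≢w x≢y z≢w z≢y (≢-sym y≢w)
        degrees = deg-⊕-square G Gxz Gzw (adj-sym G Gyw) (adj-sym G Gxy)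
      by-zw true Gzw = record
        { G′           = G
        ; H′           = H ⊕ square
        ; extends      = toggleʳ-extends square degrees
        ; same-degrees = λ _ → refl
        ; smaller      = subst (_< size (G ⊕ H)) (sym (size-⊕ʳ G H square))
            (size-⊕-square (G ⊕ H) Dxy (adj-sym (G ⊕ H) Dxz) (inj₁ Dyw))
        }
        where
        open Square x≢y x≢w x≢z y≢w (≢-sym z≢y) (≢-sym z≢w)
        Hzw = ∖-false G H red-zw Gzw
        degrees = deg-⊕-square H Hxy Hyw (adj-sym H Hzw) (adj-sym H Hxz)

  find-chord : ∀ {k G H} → Extends (suc k) G H → StarAt v (H ∖ G) →
    ∃₂ λ s t → adj H v s ≡ true × adj H v t ≡ true × adj (G ∖ H) s t ≡ true
  find-chord {k} {G} {H} ext star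
    with s , Hvs ← count-pos (adj H v) (subst (0 <_) (sym (Extends.deg-v ext)) (s≤s z≤n))
    with s≢v ← ≢-sym (adj⇒≢ H Hvs)
    with t , st ← red-of-blue ext s≢v (∖-intro H G (adj-sym H Hvs) (adj-sym G (Extends.v-isolated ext s)))
    with t≢v ← edge-avoids-isolatedʳ {G = G} (Extends.v-isolated ext) (proj₁ (∖-true G H st))
    with r , tr ← blue-of-red ext t≢v (adj-sym (G ∖ H) st)
    with r ≟ v
  ... | yes refl = s , t , Hvs , adj-sym H (proj₁ (∖-true H G tr)) , st
  ... | no r≢v   = contradiction (trans (sym (star t r t≢v r≢v)) tr) λ ()

  module SplitOff {k G H s t} (ext : Extends (suc k) G H) (star : StarAt v (H ∖ G))
                  (Hvs : adj H v s ≡ true) (Hvt : adj H v t ≡ true)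
                  (red-st : adj (G ∖ H) s t ≡ true) where
    open Extends ext

    private
      Gst = proj₁ (∖-true G H red-st)
      Hst = proj₂ (∖-true G H red-st)
      v≢s = adj⇒≢ H Hvs
      v≢t = adj⇒≢ H Hvt
      s≢t = adj⇒≢ G Gst

    open Triangle v≢s v≢t s≢t

    H₁ : SimpleGraph N
    H₁ = H ⊕ triangle

    extends₁ : Extends k G H₁
    extends₁ = record
      { v-isolated = v-isolated
      ; balanced   = triangle-elim (λ u → u ≢ v → deg G u ≡ deg H₁ u)
          (λ v≢v → contradiction refl v≢v)
          (λ s≢v → trans (balanced s s≢v)
                     (sym (deg-⊕-exchange H triangle triangle-b v≢t (adj-sym H Hvs) Hst)))
          (λ t≢v → trans (balanced t t≢v)
                     (sym (deg-⊕-exchange H triangle triangle-c v≢s (adj-sym H Hvt) (adj-sym H Hst))))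
          (λ u iso u≢v → trans (balanced u u≢v) (sym (deg-⊕-isolated H triangle iso)))
      ; deg-v      = +-cancelʳ-≡ 2 _ _
          (trans (deg-⊕-loses₂ H triangle triangle-a s≢t Hvs Hvt) (trans deg-v (double-suc k)))
      }

    star₁ : StarAt v (H₁ ∖ G)
    star₁ x y x≢v y≢v = by-triangle (adj triangle x y) refl
      where
      G-edge : (x ≡ s × y ≡ t) ⊎ (x ≡ t × y ≡ s) → adj G x y ≡ true
      G-edge (inj₁ (refl , refl)) = Gst
      G-edge (inj₂ (refl , refl)) = adj-sym G Gst
      by-triangle : ∀ b → adj triangle x y ≡ b → adj (H₁ ∖ G) x y ≡ false
      by-triangle false e =
        trans (cong (λ c → c ∧ not (adj G x y)) (⊕-off H triangle e)) (star x y x≢v y≢v)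
      by-triangle true  e = ∖-absentʳ H₁ G (G-edge (triangle-avoiding-a e x≢v y≢v))

    s-isolated : Isolated (G ∖ H₁) s
    s-isolated = red-isolated extends₁ star₁ (≢-sym v≢s)
      (cong₂ _xor_ (adj-sym H Hvs) (trans (triangle-b v) (pair-here v t)))

    t-isolated : Isolated (G ∖ H₁) t
    t-isolated = red-isolated extends₁ star₁ (≢-sym v≢t)
      (cong₂ _xor_ (adj-sym H Hvt) (trans (triangle-c v) (pair-here v s)))

    shrink : (G ∖ H₁) ⊆ (G ∖ H)
    shrink i j e = subst (λ b → adj G i j ∧ not b ≡ true) H₁≡H e
      where
      i≢v = edge-avoids-isolatedˡ {G = G} v-isolated (proj₁ (∖-true G H₁ e))
      i≢s = edge-avoids-isolatedˡ {G = G ∖ H₁} s-isolated e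
      i≢t = edge-avoids-isolatedˡ {G = G ∖ H₁} t-isolated e
      H₁≡H = ⊕-off H triangle (triangle-outside i≢v i≢s i≢t j)

  extract : ∀ k {G H} → Extends k G H → StarAt v (H ∖ G) → Matching (G ∖ H) k
  extract zero    _ _ = record { edge = λ () ; isEdge = λ () ; disjoint = λ () }
  extract (suc k) ext star with s , t , Hvs , Hvt , red-st ← find-chord ext star =
    consᴹ red-st (Matching-mono shrink M₁)
          (isolated⇒uncovered M₁ s-isolated) (isolated⇒uncovered M₁ t-isolated)
    where
    open SplitOff ext star Hvs Hvt red-st
    M₁ = extract k extends₁ star₁

  descend : ∀ fuel {k G H} → Extends k G H → size (G ⊕ H) < fuel →
    Σ (SimpleGraph N) λ G′ → Isolated G′ v × (∀ u → deg G′ u ≡ deg G u) × Matching G′ k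
  descend (suc fuel) {k} {G} {H} ext size<
    with any? (λ x → any? (λ y → ¬? (x ≟ v) ×-dec ¬? (y ≟ v) ×-dec (adj (H ∖ G) x y ≟ᵇ true)))
  ... | yes (x , y , x≢v , y≢v , xy) =
    let open Improvement (improve ext (find-switch ext (suc N) x≢v y≢v xy (m≤n+m (suc N) _)))
        G″ , G″-isolated , G″-degrees , M = descend fuel extends (<-≤-trans smaller (s≤s⁻¹ size<))
    in G″ , G″-isolated , (λ u → trans (G″-degrees u) (same-degrees u)) , M
  ... | no none =
    G , Extends.v-isolated ext , (λ _ → refl) , Matching-mono (∖-⊆ G H) (extract k ext star)
    where
    star : StarAt v (H ∖ G)
    star x y x≢v y≢v = ¬-not (λ xy → none (x , y , x≢v , y≢v , xy))

  undo-split-off : ∀ {k G H s t} (s≢t : s ≢ t) (s≢v : s ≢ v) (t≢v : t ≢ v) → Extends k G H →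
    adj H s t ≡ true → adj H s v ≡ false → adj H t v ≡ false →
    Extends (suc k) G (H ⊕ Triangle.triangle s≢t s≢v t≢v)
  undo-split-off {k} {G} {H} {s} {t} s≢t s≢v t≢v ext Hst Hsv Htv = record
    { v-isolated = v-isolated
    ; balanced   = triangle-elim (λ u → u ≢ v → deg G u ≡ deg (H ⊕ triangle) u)
        (λ _ → trans (balanced s s≢v) (sym (deg-⊕-exchange H triangle triangle-a t≢v Hst Hsv)))
        (λ _ → trans (balanced t t≢v)
                 (sym (deg-⊕-exchange H triangle triangle-b s≢v (adj-sym H Hst) Htv)))
        (λ v≢v → contradiction refl v≢v)
        (λ u iso u≢v → trans (balanced u u≢v) (sym (deg-⊕-isolated H triangle iso)))
    ; deg-v      = begin
        deg (H ⊕ triangle) v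
          ≡⟨ deg-⊕-gains₂ H triangle triangle-c s≢t (adj-sym H Hsv) (adj-sym H Htv) ⟩
        deg H v + 2
          ≡⟨ cong (_+ 2) deg-v ⟩
        2 * k + 2
          ≡⟨ double-suc k ⟨
        2 * suc k ∎
    }
    where
    open Extends ext
    open Triangle s≢t s≢v t≢v
    open ≡-Reasoning

  extend-by-matching : ∀ {G} → Isolated G v → ∀ k (M : Matching G k) → Σ (SimpleGraph N) λ H →
    Extends k G H × (∀ u → u ≢ v → ¬ Covers M u → ∀ j → adj H u j ≡ adj G u j)
  extend-by-matching {G} v-isolated zero M =
    G , record { v-isolated = v-isolated ; balanced = λ _ _ → refl ; deg-v = count-false v-isolated }
      , λ _ _ _ _ → refl
  extend-by-matching {G} v-isolated (suc k) M
    with H , ext , unchanged ← extend-by-matching v-isolated k (tailᴹ M) =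
    H ⊕ triangle
      , undo-split-off s≢t s≢v t≢v ext Hst (v-absent s≢v s∉) (v-absent t≢v t∉)
      , unchanged′
    where
    s = proj₁ (Matching.edge M zero)
    t = proj₂ (Matching.edge M zero)
    Gst = matched-adj M zero
    s≢t = adj⇒≢ G Gst
    s≢v = edge-avoids-isolatedˡ {G = G} v-isolated Gst
    t≢v = edge-avoids-isolatedʳ {G = G} v-isolated Gst
    s∉ = proj₁ (tailᴹ-avoids-head M)
    t∉ = proj₂ (tailᴹ-avoids-head M)
    v-absent : ∀ {u} → u ≢ v → ¬ Covers (tailᴹ M) u → adj H u v ≡ false
    v-absent {u} u≢v u∉ = trans (unchanged u u≢v u∉ v) (adj-sym G (v-isolated u))
    Hst = trans (unchanged s s≢v s∉ t) Gst
    open Triangle s≢t s≢v t≢v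
    unchanged′ : ∀ u → u ≢ v → ¬ Covers M u → ∀ j → adj (H ⊕ triangle) u j ≡ adj G u j
    unchanged′ u u≢v u∉M j = trans (⊕-off H triangle (triangle-outside u≢s u≢t u≢v j))
                                   (unchanged u u≢v (λ (a , e) → u∉M (suc a , e)) j)
      where
      u≢s = λ u≡s → u∉M (zero , inj₁ u≡s)
      u≢t = λ u≡t → u∉M (zero , inj₂ u≡t)

-- Adding and deleting the last vertex

fromInject₁ : ∀ {n} → Fin (suc n) → Maybe (Fin n)
fromInject₁ {zero}  zero    = nothing
fromInject₁ {suc n} zero    = just zero
fromInject₁ {suc n} (suc i) = Maybe.map suc (fromInject₁ i)

fromInject₁-inject₁ : ∀ {n} (i : Fin n) → fromInject₁ (inject₁ i) ≡ just i
fromInject₁-inject₁ {suc n} zero    = refl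
fromInject₁-inject₁ {suc n} (suc i) = cong (Maybe.map suc) (fromInject₁-inject₁ i)

fromInject₁-fromℕ : ∀ n → fromInject₁ (fromℕ n) ≡ nothing
fromInject₁-fromℕ zero    = refl
fromInject₁-fromℕ (suc n) = cong (Maybe.map suc) (fromInject₁-fromℕ n)

≢fromℕ⇒inject₁ : ∀ {n} {u : Fin (suc n)} → u ≢ fromℕ n → ∃ λ j → inject₁ j ≡ u
≢fromℕ⇒inject₁ {n} {u} u≢n = lower₁ u n≢u , inject₁-lower₁ u n≢u
  where
  n≢u : n ≢ toℕ u
  n≢u n≡u = u≢n (Fin.toℕ-injective (trans (sym n≡u) (sym (toℕ-fromℕ n))))

module _ {n : ℕ} where

  extend : SimpleGraph n → SimpleGraph (suc n)
  extend G = record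
    { adj    = λ i j → adjᵐ (fromInject₁ i) (fromInject₁ j)
    ; sym    = λ i j → adjᵐ-sym (fromInject₁ i) (fromInject₁ j)
    ; irrefl = λ i → adjᵐ-irrefl (fromInject₁ i)
    }
    where
    adjᵐ : Maybe (Fin n) → Maybe (Fin n) → Bool
    adjᵐ a b = fromMaybe false (Maybe.zipWith (adj G) a b)
    adjᵐ-sym : ∀ a b → adjᵐ a b ≡ adjᵐ b a
    adjᵐ-sym (just a) (just b) = SimpleGraph.sym G a b
    adjᵐ-sym (just a) nothing  = refl
    adjᵐ-sym nothing  (just b) = refl
    adjᵐ-sym nothing  nothing  = refl
    adjᵐ-irrefl : ∀ a → adjᵐ a a ≡ false
    adjᵐ-irrefl (just a) = irrefl G a
    adjᵐ-irrefl nothing  = refl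

  restrict : SimpleGraph (suc n) → SimpleGraph n
  restrict G = record
    { adj    = λ i j → adj G (inject₁ i) (inject₁ j)
    ; sym    = λ i j → SimpleGraph.sym G (inject₁ i) (inject₁ j)
    ; irrefl = λ i → irrefl G (inject₁ i)
    }

  extend-inject₁ : ∀ (G : SimpleGraph n) i j → adj (extend G) (inject₁ i) (inject₁ j) ≡ adj G i j
  extend-inject₁ G i j rewrite fromInject₁-inject₁ i | fromInject₁-inject₁ j = refl

  extend-isolated : ∀ (G : SimpleGraph n) → Isolated (extend G) (fromℕ n)
  extend-isolated G j rewrite fromInject₁-fromℕ n = refl

  deg-extend : ∀ (G : SimpleGraph n) i → deg (extend G) (inject₁ i) ≡ deg G i
  deg-extend G i = begin
    deg (extend G) (inject₁ i)
      ≡⟨ count-inject₁ (adj (extend G) (inject₁ i)) ⟩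
    count (adj (extend G) (inject₁ i) ∘ inject₁) + bit (adj (extend G) (inject₁ i) (fromℕ n))
      ≡⟨ cong₂ (λ c b → c + bit b) (count-cong (extend-inject₁ G i))
               (adj-sym (extend G) (extend-isolated G (inject₁ i))) ⟩
    deg G i + 0
      ≡⟨ +-identityʳ _ ⟩
    deg G i ∎
    where open ≡-Reasoning

  deg-restrict : ∀ (G : SimpleGraph (suc n)) → Isolated G (fromℕ n) →
    ∀ i → deg (restrict G) i ≡ deg G (inject₁ i)
  deg-restrict G iso i = sym (begin
    deg G (inject₁ i)
      ≡⟨ count-inject₁ (adj G (inject₁ i)) ⟩
    deg (restrict G) i + bit (adj G (inject₁ i) (fromℕ n))
      ≡⟨ cong (λ b → deg (restrict G) i + bit b) (adj-sym G (iso (inject₁ i))) ⟩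
    deg (restrict G) i + 0
      ≡⟨ +-identityʳ _ ⟩
    deg (restrict G) i ∎)
    where open ≡-Reasoning

  Matching-extend : ∀ {G : SimpleGraph n} {k} → Matching G k → Matching (extend G) k
  Matching-extend {G} M = record
    { edge     = λ a → inject₁ (proj₁ (edge a)) , inject₁ (proj₂ (edge a))
    ; isEdge   = λ a → subst T (sym (extend-inject₁ G _ _)) (isEdge a)
    ; disjoint = λ a b a≢b → let p₁ , p₂ , q₁ , q₂ = disjoint a b a≢b in
        p₁ ∘ Fin.inject₁-injective , p₂ ∘ Fin.inject₁-injective ,
        q₁ ∘ Fin.inject₁-injective , q₂ ∘ Fin.inject₁-injective
    }
    where open Matching M

  Matching-restrict : ∀ {G : SimpleGraph (suc n)} {k} → Isolated G (fromℕ n) →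
    Matching G k → Matching (restrict G) k
  Matching-restrict {G} iso M = record
    { edge     = λ a → proj₁ (lowerˡ a) , proj₁ (lowerʳ a)
    ; isEdge   = λ a → subst T (sym (cong₂ (adj G) (proj₂ (lowerˡ a)) (proj₂ (lowerʳ a)))) (isEdge a)
    ; disjoint = λ a b a≢b → let p₁ , p₂ , q₁ , q₂ = disjoint a b a≢b in
        (λ e → p₁ (lowered (lowerˡ a) (lowerˡ b) e)) , (λ e → p₂ (lowered (lowerˡ a) (lowerʳ b) e)) ,
        (λ e → q₁ (lowered (lowerʳ a) (lowerˡ b) e)) , (λ e → q₂ (lowered (lowerʳ a) (lowerʳ b) e))
    }
    where
    open Matching M
    lowerˡ : ∀ a → ∃ λ j → inject₁ j ≡ proj₁ (edge a)
    lowerˡ a = ≢fromℕ⇒inject₁ (edge-avoids-isolatedˡ {G = G} iso (matched-adj M a))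
    lowerʳ : ∀ a → ∃ λ j → inject₁ j ≡ proj₂ (edge a)
    lowerʳ a = ≢fromℕ⇒inject₁ (edge-avoids-isolatedʳ {G = G} iso (matched-adj M a))
    lowered : ∀ {p q} (lp : ∃ λ j → inject₁ j ≡ p) (lq : ∃ λ j → inject₁ j ≡ q) →
      proj₁ lp ≡ proj₁ lq → p ≡ q
    lowered (i , refl) (j , refl) i≡j = cong inject₁ i≡j

lookup-∷ʳ-inject₁ : ∀ {A : Set} {n} (d : Vec A n) x i → lookup (d ∷ʳ x) (inject₁ i) ≡ lookup d i
lookup-∷ʳ-inject₁ (y ∷ d) x zero    = refl
lookup-∷ʳ-inject₁ (y ∷ d) x (suc i) = lookup-∷ʳ-inject₁ d x i

lookup-∷ʳ-fromℕ : ∀ {A : Set} {n} (d : Vec A n) x → lookup (d ∷ʳ x) (fromℕ n) ≡ x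
lookup-∷ʳ-fromℕ []      x = refl
lookup-∷ʳ-fromℕ (y ∷ d) x = lookup-∷ʳ-fromℕ d x

∷ʳ-pointwise : ∀ {A : Set} {n} (d : Vec A n) x (F : Fin (suc n) → A) →
  (∀ j → F (inject₁ j) ≡ lookup d j) → F (fromℕ n) ≡ x → ∀ i → F i ≡ lookup (d ∷ʳ x) i
∷ʳ-pointwise []      x F _     last zero    = last
∷ʳ-pointwise (y ∷ d) x F front last zero    = front zero
∷ʳ-pointwise (y ∷ d) x F front last (suc i) = ∷ʳ-pointwise d x (F ∘ suc) (front ∘ suc) last i

realizes⇒deg : ∀ {n} (G : SimpleGraph n) d → Realizes G d → ∀ i → deg G i ≡ lookup d i
realizes⇒deg G d G-realizes i = trans (sym (degree≡count G i)) (G-realizes i)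

deg⇒realizes : ∀ {n} (G : SimpleGraph n) d → (∀ i → deg G i ≡ lookup d i) → Realizes G d
deg⇒realizes G d degs i = trans (degree≡count G i) (degs i)

realizations-extend : ∀ {n} (d : Vec ℕ n) k (G : SimpleGraph n) H →
  Realizes G d → Realizes H (d ∷ʳ (2 * k)) → Extends (fromℕ n) k (extend G) H
realizations-extend {n} d k G H G-realizes H-realizes = record
  { v-isolated = extend-isolated G
  ; balanced   = balanced
  ; deg-v      = trans (realizes⇒deg H (d ∷ʳ (2 * k)) H-realizes (fromℕ n)) (lookup-∷ʳ-fromℕ d _)
  }
  where
  balanced : ∀ u → u ≢ fromℕ n → deg (extend G) u ≡ deg H u
  balanced u u≢v with j , refl ← ≢fromℕ⇒inject₁ u≢v = begin
    deg (extend G) (inject₁ j)         ≡⟨ deg-extend G j ⟩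
    deg G j                            ≡⟨ realizes⇒deg G d G-realizes j ⟩
    lookup d j                         ≡⟨ lookup-∷ʳ-inject₁ d _ j ⟨
    lookup (d ∷ʳ (2 * k)) (inject₁ j)  ≡⟨ realizes⇒deg H (d ∷ʳ (2 * k)) H-realizes (inject₁ j) ⟨
    deg H (inject₁ j)                  ∎
    where open ≡-Reasoning

graphic-extension⇒matching : ∀ {n} (d : Vec ℕ n) → Graphic d → ∀ k →
  Graphic (d ∷ʳ (2 * k)) → Σ (SimpleGraph n) λ G → Realizes G d × Matching G k
graphic-extension⇒matching {n} d (G₀ , G₀-realizes) k (H , H-realizes)
  with G , G-isolated , G-degrees , M ←
         descend (fromℕ n) (suc (size (extend G₀ ⊕ H)))
                 (realizations-extend d k G₀ H G₀-realizes H-realizes) ≤-refl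
  = restrict G , deg⇒realizes (restrict G) d restrict-degrees , Matching-restrict G-isolated M
  where
  restrict-degrees : ∀ i → deg (restrict G) i ≡ lookup d i
  restrict-degrees i = begin
    deg (restrict G) i           ≡⟨ deg-restrict G G-isolated i ⟩
    deg G (inject₁ i)            ≡⟨ G-degrees (inject₁ i) ⟩
    deg (extend G₀) (inject₁ i)  ≡⟨ deg-extend G₀ i ⟩
    deg G₀ i                     ≡⟨ realizes⇒deg G₀ d G₀-realizes i ⟩
    lookup d i                   ∎
    where open ≡-Reasoning

matching⇒graphic-extension : ∀ {n} (d : Vec ℕ n) k →
  (Σ (SimpleGraph n) λ G → Realizes G d × Matching G k) → Graphic (d ∷ʳ (2 * k))
matching⇒graphic-extension {n} d k (G , G-realizes , M)
  with H , ext , _ ← extend-by-matching (fromℕ n) (extend-isolated G) k (Matching-extend M) =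
  H , deg⇒realizes H (d ∷ʳ (2 * k)) (∷ʳ-pointwise d (2 * k) (deg H) front (Extends.deg-v ext))
  where
  front : ∀ j → deg H (inject₁ j) ≡ lookup d j
  front j = begin
    deg H (inject₁ j)           ≡⟨ Extends.balanced ext (inject₁ j) (Fin.fromℕ≢inject₁ ∘ sym) ⟨
    deg (extend G) (inject₁ j)  ≡⟨ deg-extend G j ⟩
    deg G j                     ≡⟨ realizes⇒deg G d G-realizes j ⟩
    lookup d j                  ∎
    where open ≡-Reasoning

theorem2p5 : (n : ℕ) (d : Vec ℕ n) → Graphic d → (k : ℕ) → 0 < k → 2 * k ≤ n →
    (Graphic (d ∷ʳ (2 * k)) ⇔ Σ (SimpleGraph n) λ G → Realizes G d × Matching G k)
theorem2p5 n d d-graphic k _ _ =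
  mk⇔ (graphic-extension⇒matching d d-graphic k) (matching⇒graphic-extension d k)
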